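{- Let $\mathfrak{F}=\langle W,R\rangle$ be an $\mathbf{S4}$ frame and $f$ a normal hereditary union function in $\mathfrak{F}$. Let $m,n,l\in\omega$ with $m+l\ge1$ and $n+l\ge1$, let $a_0,\dots,a_{m-1},b_0,\dots,b_{n-1}\in W$, $\langle x_0,y_0\rangle,\dots,\langle x_{l-1},y_{l-1}\rangle\in\mathrm{dom}(f)$, and $u_1,u_2\in W$ with $\langle u_1,u_2\rangle\in\mathrm{dom}(f)$. If $u_1$ strongly unites $a_0,\dots,a_{m-1},x_0,\dots,x_{l-1}$ and $u_2$ strongly unites $b_0,\dots,b_{n-1},y_0,\dots,y_{l-1}$, then $f(u_1,u_2)$ strongly unites $a_0,\dots,a_{m-1},f(x_0,y_0),\dots,f(x_{l-1},y_{l-1}),b_0,\dots,b_{n-1}$.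
   Context: An $\mathbf{S4}$ frame is a set $W$ with a reflexive transitive relation $R$. For $X\subseteq W$: $\mathord{\uparrow}X=\{w:\exists x\in X,\ xRw\}$, $\Diamond X=\{w:\exists x\in X,\ wRx\}$, $\Box X=\{w:\forall v(wRv\Rightarrow v\in X)\}$. For $k\ge1$, $z$ strongly unites $z_0,\dots,z_{k-1}$ if for every $i<k$: $zRz_i$ and $z\in\Box\big(\mathord{\uparrow}\{z_i\}\cup\bigcup_{i'\in k\setminus\{i\}}\Diamond\mathord{\uparrow}\{z_{i'}\}\big)$. A partial function $f:W\times W\rightharpoonup W$ is a hereditary union function in $\mathfrak{F}$ if $\mathrm{dom}(f)$ is closed under $R^\sharp$-successors (where $\langle w,v\rangle R^\sharp\langle w',v'\rangle$ iff $wRw'$ and $vRv'$), and for every $\langle w,v\rangle\in\mathrm{dom}(f)$: $f(w,v)Rw$, $f(w,v)Rv$, and for every $t$ with $f(w,v)Rt$, either $wRt$, or $vRt$, or there are $w',v'$ with $wRw'$, $vRv'$ and $t=f(w',v')$. It is normal if for all $\langle w,v\rangle,\langle w',v'\rangle\in\mathrm{dom}(f)$ with $wRw'$ and $vRv'$ we have $f(w,v)Rf(w',v')$. -}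

module Defs where

open import Level using (Level; _⊔_; suc)
open import Data.Nat using (ℕ)
open import Data.Fin using (Fin)
open import Data.Product using (Σ; ∃; _×_; _,_)
open import Data.Sum using (_⊎_)
open import Relation.Binary.PropositionalEquality using (_≡_)
open import Relation.Nullary using (¬_)

record S4Frame (a r : Level) : Set (suc (a ⊔ r)) where
  field
    W     : Set a
    R     : W → W → Set r
    reflR : ∀ w → R w w
    transR : ∀ {u v w} → R u v → R v w → R u w

module _ {a r : Level} (F : S4Frame a r) where
  open S4Frame F

  -- z strongly unites z₀,…,z_{k-1}:  for every i, z R zᵢ and
  -- z ∈ □( ↑{zᵢ} ∪ ⋃_{i' ≠ i} ◇↑{z_{i'}} ).
  StronglyUnites : W → (k : ℕ) → (Fin k → W) → Set (a ⊔ r)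
  StronglyUnites z k zs =
    (i : Fin k) →
      R z (zs i) ×
      (∀ v → R z v →
        R (zs i) v ⊎
        Σ (Fin k) λ i' → ¬ (i' ≡ i) × Σ W λ t → R v t × R (zs i') t)

  record PartialBinFun (d : Level) : Set (suc d ⊔ a) where
    field
      Dom : W → W → Set d
      app : (w v : W) → Dom w v → W
      app-irr : ∀ w v (p q : Dom w v) → app w v p ≡ app w v q

  module _ {d : Level} (f : PartialBinFun d) where
    open PartialBinFun f

    IsHereditaryUnionFunction : Set (a ⊔ r ⊔ d)
    IsHereditaryUnionFunction =
      (∀ {w v w' v'} → Dom w v → R w w' → R v v' → Dom w' v') ×
      (∀ w v (p : Dom w v) →
        R (app w v p) w ×
        R (app w v p) v ×
        (∀ t → R (app w v p) t →
          R w t ⊎ R v t ⊎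
          Σ W λ w' → Σ W λ v' → Σ (Dom w' v') λ q →
            R w w' × R v v' × t ≡ app w' v' q))

    IsNormal : Set (a ⊔ r ⊔ d)
    IsNormal =
      ∀ w v w' v' (p : Dom w v) (q : Dom w' v') →
        R w w' → R v v' → R (app w v p) (app w' v' q)

{-# OPTIONS --safe #-}
module Submission where

-- Every new member lies R-below an old one (f(xⱼ,yⱼ) R xⱼ and f(xⱼ,yⱼ) R yⱼ),
-- so the separating witnesses of u₁ and u₂ carry over to the new family. A
-- successor of f(u₁,u₂) lies above u₁, above u₂, or is some f(w',v') below
-- w' ⊒ u₁ and v' ⊒ u₂. Above u₂ every point sees some bₖ or f(xⱼ,yⱼ), which
-- separates it from each aᵢ (symmetrically for the bₖ); and f(w',v') either
-- escapes through w' or v', or has w' ⊒ xⱼ and v' ⊒ yⱼ, and then lies above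
-- f(xⱼ,yⱼ) by normality.

open import Defs
open import Level using (Level; _⊔_)
open import Data.Nat using (ℕ; _+_; _≥_)
open import Data.Fin using (Fin; splitAt; fromℕ<)
open import Data.Fin.Properties using (+↔⊎; splitAt-join)
open import Data.Vec.Functional using (_++_)
open import Data.Product using (Σ; ∃; _×_; _,_; proj₁; proj₂)
open import Data.Sum using (_⊎_; inj₁; inj₂; [_,_])
open import Data.Sum.Properties using ([,]-map)
open import Data.Sum.Function.Propositional using (_⊎-cong_)
open import Function using (_∘_; _↠_; Surjection)
open import Function.Definitions using (Injective)
open import Function.Properties.Inverse using (↔-refl; ↔-sym; ↔⇒↠)
open import Relation.Binary.PropositionalEquality
  using (_≡_; _≢_; _≗_; refl; sym; trans; cong; subst)
open import Relation.Nullary using (¬_)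

module _ {a r : Level} (F : S4Frame a r) where
  open S4Frame F

  _∈◇↑_ : W → W → Set (a ⊔ r)
  v ∈◇↑ w = Σ W λ t → R v t × R w t

  Escapes : {I : Set} → (I → W) → I → W → Set (a ⊔ r)
  Escapes {I} zs i v = Σ I λ i' → ¬ (i' ≡ i) × v ∈◇↑ zs i'

  Covered : {I : Set} → (I → W) → I → W → Set (a ⊔ r)
  Covered zs i v = R (zs i) v ⊎ Escapes zs i v

  -- Strong uniting of a family over an arbitrary index set;
  -- StronglyUnites F z k is definitionally the instance I = Fin k.
  StronglyUnites′ : {I : Set} → W → (I → W) → Set (a ⊔ r)
  StronglyUnites′ {I} z zs = (i : I) → R z (zs i) × (∀ v → R z v → Covered zs i v)

  ∈◇↑-downˡ : ∀ {v v' w} → R v v' → v' ∈◇↑ w → v ∈◇↑ w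
  ∈◇↑-downˡ vv' (t , v't , wt) = t , transR vv' v't , wt

  ∈◇↑-downʳ : ∀ {v w w'} → R w w' → v ∈◇↑ w' → v ∈◇↑ w
  ∈◇↑-downʳ ww' (t , vt , w't) = t , vt , transR ww' w't

  Escapes-down : ∀ {I} {zs : I → W} {i v v'} → R v v' → Escapes zs i v' → Escapes zs i v
  Escapes-down vv' (i' , i'≢i , v'◇zi') = i' , i'≢i , ∈◇↑-downˡ vv' v'◇zi'

  ∈◇↑-some-member : ∀ {I} {zs : I → W} {u v} →
    StronglyUnites′ u zs → I → R u v → ∃ λ i → v ∈◇↑ zs i
  ∈◇↑-some-member {v = v} U i₀ uv with proj₂ (U i₀) v uv
  ... | inj₁ zi₀v = i₀ , v , reflR v , zi₀v
  ... | inj₂ (i' , _ , v◇zi') = i' , v◇zi'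

  StronglyUnites′-reindex : ∀ {I J} {zs : I → W} {cs : J → W} {z} (σ : J ↠ I) →
    cs ≗ zs ∘ Surjection.to σ → StronglyUnites′ z zs → StronglyUnites′ z cs
  StronglyUnites′-reindex {zs = zs} {cs} σ cs≗ U j =
    subst (R _) (sym (cs≗ j)) (proj₁ (U (to j))) , covered
    where
    open Surjection σ using (to; to⁻; to∘to⁻)

    cs∘to⁻ : ∀ i → cs (to⁻ i) ≡ zs i
    cs∘to⁻ i = trans (cs≗ (to⁻ i)) (cong zs (to∘to⁻ i))

    covered : ∀ v → R _ v → Covered cs j v
    covered v zv with proj₂ (U (to j)) v zv
    ... | inj₁ z[toj]v = inj₁ (subst (λ w → R w v) (sym (cs≗ j)) z[toj]v)
    ... | inj₂ (i' , i'≢toj , v◇zi') =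
      inj₂ ( to⁻ i'
           , (λ to⁻i'≡j → i'≢toj (trans (sym (to∘to⁻ i')) (cong to to⁻i'≡j)))
           , subst (v ∈◇↑_) (sym (cs∘to⁻ i')) v◇zi')

  StronglyUnites-++⁻ : ∀ {p q} {ys : Fin p → W} {zs : Fin q → W} {u} →
    StronglyUnites F u (p + q) (ys ++ zs) → StronglyUnites′ u [ ys , zs ]
  StronglyUnites-++⁻ {p} {q} {ys} {zs} =
    StronglyUnites′-reindex (↔⇒↠ (↔-sym +↔⊎)) (cong [ ys , zs ] ∘ sym ∘ splitAt-join p q)

  StronglyUnites-++⁺ : ∀ {p q} {ys : Fin p → W} {zs : Fin q → W} {u} →
    StronglyUnites′ u [ ys , zs ] → StronglyUnites F u (p + q) (ys ++ zs)
  StronglyUnites-++⁺ = StronglyUnites′-reindex (↔⇒↠ +↔⊎) (λ _ → refl)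

  module _ {I J : Set} {zs : I → W} {cs : J → W} {ι : I → J}
           (ι-injective : Injective _≡_ _≡_ ι) (cs∘ι-below : ∀ i → R (cs (ι i)) (zs i)) where

    Escapes-map : ∀ {i v} → Escapes zs i v → Escapes cs (ι i) v
    Escapes-map (i' , i'≢i , v◇zi') =
      ι i' , i'≢i ∘ ι-injective , ∈◇↑-downʳ (cs∘ι-below i') v◇zi'

    Covered-map : ∀ {i v} → Covered zs i v → Covered cs (ι i) v
    Covered-map {i} (inj₁ ziv) = inj₁ (transR (cs∘ι-below i) ziv)
    Covered-map (inj₂ esc)     = inj₂ (Escapes-map esc)

    Escapes-off-image : ∀ {j v} → (∀ i → ι i ≢ j) → ∃ (λ i → v ∈◇↑ zs i) → Escapes cs j v
    Escapes-off-image ι≢j (i , v◇zi) = ι i , ι≢j i , ∈◇↑-downʳ (cs∘ι-below i) v◇zi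

module _ {a r d : Level} {F : S4Frame a r} {f : PartialBinFun F d}
         (hered : IsHereditaryUnionFunction F f) (normal : IsNormal F f) where
  open S4Frame F
  open PartialBinFun f

  app-belowˡ : ∀ {w v} (p : Dom w v) → R (app w v p) w
  app-belowˡ p = proj₁ (proj₂ hered _ _ p)

  app-belowʳ : ∀ {w v} (p : Dom w v) → R (app w v p) v
  app-belowʳ p = proj₁ (proj₂ (proj₂ hered _ _ p))

  app-successor : ∀ {w v} (p : Dom w v) {t} → R (app w v p) t →
    R w t ⊎ R v t ⊎ Σ W λ w' → Σ W λ v' → Σ (Dom w' v') λ q →
      R w w' × R v v' × t ≡ app w' v' q
  app-successor p {t} = proj₂ (proj₂ (proj₂ hered _ _ p)) t

  module _ {A B X : Set} (as : A → W) (bs : B → W) (xs ys : X → W)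
           (xy∈ : ∀ x → Dom (xs x) (ys x)) {u₁ u₂ : W} (u∈ : Dom u₁ u₂)
           (e₀ : A ⊎ X) (g₀ : B ⊎ X)
           (U₁ : StronglyUnites′ F u₁ [ as , xs ]) (U₂ : StronglyUnites′ F u₂ [ bs , ys ]) where

    private
      z : W
      z = app u₁ u₂ u∈

      fxy : X → W
      fxy x = app (xs x) (ys x) (xy∈ x)

      cs : (A ⊎ X) ⊎ B → W
      cs = [ [ as , fxy ] , bs ]

      inj₁-injective : Injective _≡_ _≡_ (inj₁ {A = A ⊎ X} {B = B})
      inj₁-injective refl = refl

      ιʳ : B ⊎ X → (A ⊎ X) ⊎ B
      ιʳ = [ inj₂ , inj₁ ∘ inj₂ ]

      ιʳ-injective : Injective _≡_ _≡_ ιʳ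
      ιʳ-injective {inj₁ _} {inj₁ _} refl = refl
      ιʳ-injective {inj₁ _} {inj₂ _} ()
      ιʳ-injective {inj₂ _} {inj₁ _} ()
      ιʳ-injective {inj₂ _} {inj₂ _} refl = refl

      cs-belowˡ : ∀ e → R (cs (inj₁ e)) ([ as , xs ] e)
      cs-belowˡ (inj₁ a) = reflR (as a)
      cs-belowˡ (inj₂ x) = app-belowˡ (xy∈ x)

      cs-belowʳ : ∀ g → R (cs (ιʳ g)) ([ bs , ys ] g)
      cs-belowʳ (inj₁ b) = reflR (bs b)
      cs-belowʳ (inj₂ x) = app-belowʳ (xy∈ x)

      z-R-cs : ∀ i → R z (cs i)
      z-R-cs (inj₁ (inj₁ a)) = transR (app-belowˡ u∈) (proj₁ (U₁ (inj₁ a)))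
      z-R-cs (inj₁ (inj₂ x)) =
        normal _ _ _ _ u∈ (xy∈ x) (proj₁ (U₁ (inj₂ x))) (proj₁ (U₂ (inj₂ x)))
      z-R-cs (inj₂ b)        = transR (app-belowʳ u∈) (proj₁ (U₂ (inj₁ b)))

      escapes-viaʳ : ∀ {a v v'} → R v v' → R u₂ v' → Escapes F cs (inj₁ (inj₁ a)) v
      escapes-viaʳ vv' u₂v' =
        Escapes-down F vv' (Escapes-off-image F ιʳ-injective cs-belowʳ
          (λ { (inj₁ _) () ; (inj₂ _) () }) (∈◇↑-some-member F U₂ g₀ u₂v'))

      escapes-viaˡ : ∀ {b v w'} → R v w' → R u₁ w' → Escapes F cs (inj₂ b) v
      escapes-viaˡ vw' u₁w' =
        Escapes-down F vw' (Escapes-off-image F inj₁-injective cs-belowˡ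
          (λ _ ()) (∈◇↑-some-member F U₁ e₀ u₁w'))

      covered-fxy : ∀ x {w' v'} (q : Dom w' v') → R u₁ w' → R u₂ v' →
        Covered F cs (inj₁ (inj₂ x)) (app w' v' q)
      covered-fxy x {w'} {v'} q u₁w' u₂v'
        with proj₂ (U₁ (inj₂ x)) w' u₁w' | proj₂ (U₂ (inj₂ x)) v' u₂v'
      ... | inj₁ xw' | inj₁ yv' = inj₁ (normal _ _ _ _ (xy∈ x) q xw' yv')
      ... | inj₂ esc | _        =
        inj₂ (Escapes-down F (app-belowˡ q) (Escapes-map F inj₁-injective cs-belowˡ esc))
      ... | inj₁ _   | inj₂ esc =
        inj₂ (Escapes-down F (app-belowʳ q) (Escapes-map F ιʳ-injective cs-belowʳ esc))

      covered : ∀ i v → R z v → Covered F cs i v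
      covered i v zv with app-successor u∈ zv
      covered (inj₁ e) v _ | inj₁ u₁v =
        Covered-map F inj₁-injective cs-belowˡ (proj₂ (U₁ e) v u₁v)
      covered (inj₂ b) v _ | inj₁ u₁v = inj₂ (escapes-viaˡ (reflR v) u₁v)
      covered (inj₁ (inj₁ a)) v _ | inj₂ (inj₁ u₂v) = inj₂ (escapes-viaʳ (reflR v) u₂v)
      covered (inj₁ (inj₂ x)) v _ | inj₂ (inj₁ u₂v) =
        Covered-map F ιʳ-injective cs-belowʳ (proj₂ (U₂ (inj₂ x)) v u₂v)
      covered (inj₂ b) v _ | inj₂ (inj₁ u₂v) =
        Covered-map F ιʳ-injective cs-belowʳ (proj₂ (U₂ (inj₁ b)) v u₂v)
      covered (inj₁ (inj₁ a)) _ _ | inj₂ (inj₂ (w' , v' , q , u₁w' , u₂v' , refl)) =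
        inj₂ (escapes-viaʳ (app-belowʳ q) u₂v')
      covered (inj₁ (inj₂ x)) _ _ | inj₂ (inj₂ (w' , v' , q , u₁w' , u₂v' , refl)) =
        covered-fxy x q u₁w' u₂v'
      covered (inj₂ b) _ _ | inj₂ (inj₂ (w' , v' , q , u₁w' , u₂v' , refl)) =
        inj₂ (escapes-viaˡ (app-belowˡ q) u₁w')

    app-strongly-unites : StronglyUnites′ F z cs
    app-strongly-unites i = z-R-cs i , covered i

lemma16 : {a r d : Level} (F : S4Frame a r) (f : PartialBinFun F d) →
    IsHereditaryUnionFunction F f → IsNormal F f →
    (m n l : ℕ) → m + l ≥ 1 → n + l ≥ 1 →
    (as : Fin m → S4Frame.W F) (bs : Fin n → S4Frame.W F) →
    (xs ys : Fin l → S4Frame.W F) →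
    (xy∈ : (j : Fin l) → PartialBinFun.Dom f (xs j) (ys j)) →
    (u₁ u₂ : S4Frame.W F) (u∈ : PartialBinFun.Dom f u₁ u₂) →
    StronglyUnites F u₁ (m + l) (as ++ xs) →
    StronglyUnites F u₂ (n + l) (bs ++ ys) →
    StronglyUnites F (PartialBinFun.app f u₁ u₂ u∈) (m + l + n)
      ((as ++ (λ j → PartialBinFun.app f (xs j) (ys j) (xy∈ j))) ++ bs)
lemma16 F f hered normal m n l m+l≥1 n+l≥1 as bs xs ys xy∈ u₁ u₂ u∈ U₁ U₂ =
  StronglyUnites-++⁺ F
    (StronglyUnites′-reindex F (↔⇒↠ (+↔⊎ ⊎-cong ↔-refl)) (sym ∘ [,]-map)
      (app-strongly-unites {F = F} {f = f} hered normal as bs xs ys xy∈ u∈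
        (splitAt m (fromℕ< m+l≥1)) (splitAt n (fromℕ< n+l≥1))
        (StronglyUnites-++⁻ F U₁) (StronglyUnites-++⁻ F U₂)))
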